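{- For integers $n\ge i\ge 0$, let $H_{n,i}$ be the number of G-Motzkin paths of length $n$ with exactly $i$ $\mathbf{h}$-steps. Then \[ H_{n,i}=\sum_{k=\lfloor\frac{n-i}{2}\rfloor}^{n-i}\binom{2k+i}{2k}\binom{k}{n-i-k}C_k, \] where $C_k=\frac{1}{k+1}\binom{2k}{k}$ is the $k$-th Catalan number.
   Context: A G-Motzkin path of length $n$ is a lattice path from $(0,0)$ to $(n,0)$ that never goes below the $x$-axis and consists of up steps $\mathbf{u}=(1,1)$, down steps $\mathbf{d}=(1,-1)$, horizontal steps $\mathbf{h}=(1,0)$ and vertical steps $\mathbf{v}=(0,-1)$. -}

module Defs where

open import Data.Nat using (ℕ; zero; suc; _+_; _*_; _∸_; _/_)
open import Data.Nat.Combinatorics using (_C_)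
open import Relation.Binary.PropositionalEquality using (_≡_)
open import Data.List using (List; []; _∷_; map; applyUpTo)
open import Data.Nat.ListAction using (sum)

data Step : Set where
  U : Step
  D : Step
  H : Step
  V : Step

-- Walk h s : following the steps s starting at height h, the path never
-- goes below the x-axis and ends at height 0.
data Walk : ℕ → List Step → Set where
  done : Walk 0 []
  up   : ∀ {h s} → Walk (suc h) s → Walk h (U ∷ s)
  down : ∀ {h s} → Walk h s → Walk (suc h) (D ∷ s)
  horz : ∀ {h s} → Walk h s → Walk h (H ∷ s)
  vert : ∀ {h s} → Walk h s → Walk (suc h) (V ∷ s)

xlength : List Step → ℕ
xlength []      = 0
xlength (V ∷ s) = xlength s
xlength (_ ∷ s) = suc (xlength s)

hcount : List Step → ℕ
hcount []      = 0
hcount (H ∷ s) = suc (hcount s)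
hcount (_ ∷ s) = hcount s

record GMotzkin (n i : ℕ) (p : List Step) : Set where
  constructor gm
  field
    walk : Walk 0 p
    len  : xlength p ≡ n
    hs   : hcount p ≡ i

-- Catalan number C_k = (1/(k+1)) * binom(2k,k)  (the division is exact)
catalan : ℕ → ℕ
catalan k = ((2 * k) C k) / suc k

-- Σ_{k=a}^{b} f k  (empty when b < a)
sumFromTo : ℕ → ℕ → (ℕ → ℕ) → ℕ
sumFromTo a b f = sum (map f (applyUpTo (λ j → a + j) (suc b ∸ a)))

Hformula : ℕ → ℕ → ℕ
Hformula n i = sumFromTo ((n ∸ i) / 2) (n ∸ i)
  (λ k → ((2 * k + i) C (2 * k)) * ((k C (n ∸ i ∸ k)) * catalan k))

-- Every G-Motzkin path of length n with i h-steps has some number k of u-steps, n − i − k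
-- d-steps and 2k − (n − i) v-steps. Deleting the h-steps and reading both d and v as a down
-- step leaves a Dyck path of semilength k, and the path is recovered from that Dyck path
-- (C_k choices), the set of down steps that are d-steps (C(k, n−i−k) choices) and the
-- positions of the i h-steps among all 2k + i steps (C(2k+i, 2k) choices). The walks are
-- enumerated by their first step, the counts satisfy the corresponding Pascal-type
-- recurrences, and the reflection principle identifies the number of Dyck paths with C_k.
module Submission where

open import Defs
open import Data.Bool using (Bool; true; false; if_then_else_)
open import Data.Empty using (⊥-elim)
open import Data.List using (List; []; _∷_; [_]; map; concatMap; length; head; applyUpTo)
open import Data.List.Properties using (length-++; length-map; map-cong; ∷-injectiveʳ)
open import Data.List.Membership.Propositional using (_∈_; _∉_; find; lose)
open import Data.List.Membership.Propositional.Properties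
  using (∈-map⁺; ∈-map⁻; ∈-concatMap⁺; ∈-concatMap⁻; ∈-applyUpTo⁺; ∈-applyUpTo⁻)
open import Data.List.Relation.Binary.Disjoint.Propositional using (Disjoint)
open import Data.List.Relation.Unary.All using ([]; _∷_)
import Data.List.Relation.Unary.All as All
open import Data.List.Relation.Unary.All.Properties using () renaming (map⁺ to all-map⁺)
open import Data.List.Relation.Unary.AllPairs using ([]; _∷_)
import Data.List.Relation.Unary.AllPairs as AllPairs
open import Data.List.Relation.Unary.AllPairs.Properties using () renaming (map⁺ to allPairs-map⁺)
open import Data.List.Relation.Unary.Any using (Any; here; there; satisfied)
open import Data.List.Relation.Unary.Unique.Propositional using (Unique)
open import Data.List.Relation.Unary.Unique.Propositional.Properties using (map⁺; concat⁺; applyUpTo⁺₁)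
open import Data.Maybe using (Maybe; just; nothing)
open import Data.Nat hiding (_≡ᵇ_)
open import Data.Nat.Properties
open import Data.Nat.Combinatorics using (_C_; nCk+nC[k+1]≡[n+1]C[k+1]; nCn≡1; k>n⇒nCk≡0)
open import Data.Nat.DivMod using (/-monoˡ-≤; m*n/n≡m)
open import Data.Nat.ListAction using (sum)
open import Data.Nat.Tactic.RingSolver using (solve-∀)
open import Data.Product using (Σ; _×_; _,_)
open import Function.Bundles using (_⇔_; mk⇔; Equivalence)
open import Relation.Nullary using (yes; no)
open import Relation.Binary.PropositionalEquality hiding ([_])
open ≡-Reasoning

shuffles : ℕ → ℕ → ℕ
shuffles zero    _       = 1
shuffles (suc a) zero    = 1
shuffles (suc a) (suc b) = shuffles a (suc b) + shuffles (suc a) b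

shuffles-zeroʳ : ∀ a → shuffles a 0 ≡ 1
shuffles-zeroʳ zero    = refl
shuffles-zeroʳ (suc a) = refl

shuffles-oneˡ : ∀ b → shuffles 1 b ≡ suc b
shuffles-oneˡ zero    = refl
shuffles-oneˡ (suc b) = cong suc (shuffles-oneˡ b)

shuffles-comm : ∀ a b → shuffles a b ≡ shuffles b a
shuffles-comm zero    zero    = refl
shuffles-comm zero    (suc b) = refl
shuffles-comm (suc a) zero    = refl
shuffles-comm (suc a) (suc b) = begin
  shuffles a (suc b) + shuffles (suc a) b ≡⟨ cong₂ _+_ (shuffles-comm a (suc b)) (shuffles-comm (suc a) b) ⟩
  shuffles (suc b) a + shuffles b (suc a) ≡⟨ +-comm (shuffles (suc b) a) _ ⟩
  shuffles b (suc a) + shuffles (suc b) a ∎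

shuffles≡C : ∀ a b → shuffles a b ≡ (a + b) C a
shuffles≡C zero    b       = refl
shuffles≡C (suc a) zero    = begin
  1               ≡⟨ nCn≡1 (suc a) ⟨
  suc a C suc a   ≡⟨ cong (_C suc a) (+-identityʳ (suc a)) ⟨
  (suc a + 0) C suc a ∎
shuffles≡C (suc a) (suc b) = begin
  shuffles a (suc b) + shuffles (suc a) b
    ≡⟨ cong₂ _+_ (shuffles≡C a (suc b)) (shuffles≡C (suc a) b) ⟩
  (a + suc b) C a + suc (a + b) C suc a
    ≡⟨ cong (λ x → x C a + suc (a + b) C suc a) (+-suc a b) ⟩
  suc (a + b) C a + suc (a + b) C suc a
    ≡⟨ nCk+nC[k+1]≡[n+1]C[k+1] (suc (a + b)) a ⟩
  suc (suc (a + b)) C suc a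
    ≡⟨ cong (λ x → suc x C suc a) (+-suc a b) ⟨
  (suc a + suc b) C suc a ∎

shuffles-absorption : ∀ a b → suc a * shuffles (suc a) b ≡ suc (a + b) * shuffles a b
shuffles-absorption a       zero    rewrite shuffles-zeroʳ a | +-identityʳ a = refl
shuffles-absorption zero    (suc b) rewrite shuffles-oneˡ b = trans (*-identityˡ _) (sym (*-identityʳ _))
shuffles-absorption (suc a) (suc b) = begin
  suc (suc a) * (x + y)                         ≡⟨ split x y a ⟩
  suc a * x + x + suc (suc a) * y               ≡⟨ cong₂ (λ l r → l + x + r) (shuffles-absorption a (suc b)) (shuffles-absorption (suc a) b) ⟩
  suc (a + suc b) * x' + x + suc (suc a + b) * y' ≡⟨ cong (λ z → suc z * x' + x + suc (suc a + b) * y') (+-suc a b) ⟩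
  suc (suc (a + b)) * x' + (x' + y') + suc (suc (a + b)) * y' ≡⟨ merge x' y' (a + b) ⟩
  suc (suc (suc (a + b))) * (x' + y')           ≡⟨ cong (λ z → suc (suc z) * (x' + y')) (+-suc a b) ⟨
  suc (suc a + suc b) * (x' + y') ∎
  where
  x  = shuffles (suc a) (suc b)
  y  = shuffles (suc (suc a)) b
  x' = shuffles a (suc b)
  y' = shuffles (suc a) b
  split : ∀ x y n → suc (suc n) * (x + y) ≡ suc n * x + x + suc (suc n) * y
  split = solve-∀
  merge : ∀ x y n → suc (suc n) * x + (x + y) + suc (suc n) * y ≡ suc (suc (suc n)) * (x + y)
  merge = solve-∀

-- ballot h u counts the paths from height h down to 0 made of u up steps and h + u down steps
-- that never go below 0.
ballot : ℕ → ℕ → ℕ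
ballot h       zero    = 1
ballot zero    (suc u) = ballot 1 u
ballot (suc h) (suc u) = ballot h (suc u) + ballot (suc (suc h)) u

-- The reflection principle ballot h (j+1) = C(h+2j+2, j+1) − C(h+2j+2, j), written without subtraction.
ballot-reflection : ∀ h j → ballot h (suc j) + shuffles j (suc (suc (h + j))) ≡ shuffles (suc j) (suc (h + j))
ballot-reflection zero    zero    = refl
ballot-reflection zero    (suc j) = begin
  ballot 1 (suc j) + (shuffles j (3 + j) + shuffles (suc j) (2 + j))
    ≡⟨ +-assoc (ballot 1 (suc j)) _ _ ⟨
  ballot 1 (suc j) + shuffles j (3 + j) + shuffles (suc j) (2 + j)
    ≡⟨ cong (_+ shuffles (suc j) (2 + j)) (ballot-reflection 1 j) ⟩
  shuffles (suc j) (2 + j) + shuffles (suc j) (2 + j)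
    ≡⟨ cong (shuffles (suc j) (2 + j) +_) (shuffles-comm (suc j) (2 + j)) ⟩
  shuffles (suc j) (2 + j) + shuffles (2 + j) (suc j) ∎
ballot-reflection (suc h) zero    = begin
  ballot h 1 + 1 + 1              ≡⟨ cong (_+ 1) (ballot-reflection h 0) ⟩
  shuffles 1 (suc (h + 0)) + 1    ≡⟨ cong (_+ 1) (shuffles-oneˡ (suc (h + 0))) ⟩
  suc (suc (h + 0)) + 1           ≡⟨ +-comm (suc (suc (h + 0))) 1 ⟩
  suc (suc (suc (h + 0)))         ≡⟨ shuffles-oneˡ (suc (suc (h + 0))) ⟨
  shuffles 1 (suc (suc h + 0)) ∎
ballot-reflection (suc h) (suc j) = begin
  b₁ + b₂ + (shuffles j (3 + (h + suc j)) + shuffles (suc j) (2 + (h + suc j)))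
    ≡⟨ cong (λ x → b₁ + b₂ + (shuffles j (3 + x) + shuffles (suc j) (2 + x))) (+-suc h j) ⟩
  b₁ + b₂ + (shuffles j (4 + m) + shuffles (suc j) (3 + m))
    ≡⟨ swap b₁ b₂ (shuffles j (4 + m)) (shuffles (suc j) (3 + m)) ⟩
  (b₁ + shuffles (suc j) (3 + m)) + (b₂ + shuffles j (4 + m))
    ≡⟨ cong₂ _+_ (subst (λ x → b₁ + shuffles (suc j) (2 + x) ≡ shuffles (2 + j) (1 + x)) (+-suc h j) (ballot-reflection h (suc j)))
                 (ballot-reflection (suc (suc h)) j) ⟩
  shuffles (2 + j) (2 + m) + shuffles (suc j) (3 + m)
    ≡⟨ +-comm (shuffles (2 + j) (2 + m)) _ ⟩
  shuffles (suc j) (3 + m) + shuffles (2 + j) (2 + m)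
    ≡⟨ cong (λ x → shuffles (suc j) (2 + x) + shuffles (2 + j) (1 + x)) (+-suc h j) ⟨
  shuffles (2 + j) (suc (suc h + suc j)) ∎
  where
  m  = h + j
  b₁ = ballot h (2 + j)
  b₂ = ballot (2 + h) (suc j)
  swap : ∀ a b c d → a + b + (c + d) ≡ (a + d) + (b + c)
  swap = solve-∀

ballot-zero-*-suc : ∀ k → ballot 0 k * suc k ≡ shuffles k k
ballot-zero-*-suc zero    = refl
ballot-zero-*-suc (suc j) = +-cancelʳ-≡ (suc (suc j) * below) _ _ (begin
  ballot 0 (suc j) * suc (suc j) + suc (suc j) * below ≡⟨ collect (ballot 0 (suc j)) below j ⟩
  (ballot 0 (suc j) + below) * suc (suc j)           ≡⟨ cong (_* suc (suc j)) (ballot-reflection 0 j) ⟩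
  central * suc (suc j)                              ≡⟨ peel central j ⟩
  central + suc j * central                          ≡⟨ cong (central +_) balance ⟨
  central + suc (suc j) * below ∎)
  where
  below   = shuffles j (suc (suc j))
  central = shuffles (suc j) (suc j)
  balance : suc (suc j) * below ≡ suc j * central
  balance = begin
    suc (suc j) * below                    ≡⟨ cong (suc (suc j) *_) (shuffles-comm j (suc (suc j))) ⟩
    suc (suc j) * shuffles (suc (suc j)) j ≡⟨ shuffles-absorption (suc j) j ⟩
    suc (suc j + j) * shuffles (suc j) j   ≡⟨ cong₂ (λ x y → suc x * y) (sym (+-suc j j)) (shuffles-comm (suc j) j) ⟩
    suc (j + suc j) * shuffles j (suc j)   ≡⟨ shuffles-absorption j (suc j) ⟨
    suc j * central ∎
  collect : ∀ d x j → d * suc (suc j) + suc (suc j) * x ≡ (d + x) * suc (suc j)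
  collect = solve-∀
  peel : ∀ y j → y * suc (suc j) ≡ y + suc j * y
  peel = solve-∀

ballot-zero≡catalan : ∀ k → ballot 0 k ≡ catalan k
ballot-zero≡catalan k = sym (begin
  ((2 * k) C k) / suc k        ≡⟨ cong (λ x → ((k + x) C k) / suc k) (+-identityʳ k) ⟩
  ((k + k) C k) / suc k        ≡⟨ cong (_/ suc k) (shuffles≡C k k) ⟨
  shuffles k k / suc k         ≡⟨ cong (_/ suc k) (ballot-zero-*-suc k) ⟨
  ballot 0 k * suc k / suc k   ≡⟨ m*n/n≡m (ballot 0 k) (suc k) ⟩
  ballot 0 k ∎)

module _ {A B : Set} (f : A → List B) where

  length-concatMap : ∀ xs → length (concatMap f xs) ≡ sum (map (λ x → length (f x)) xs)
  length-concatMap []       = refl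
  length-concatMap (x ∷ xs) = trans (length-++ (f x)) (cong (length (f x) +_) (length-concatMap xs))

  concatMap-unique : (label : B → A) → (∀ x {y} → y ∈ f x → label y ≡ x) →
                     (∀ x → Unique (f x)) → ∀ {xs} → Unique xs → Unique (concatMap f xs)
  concatMap-unique label label-f f-unique xs-unique =
    concat⁺ (all-map⁺ (All.tabulate (λ {x} _ → f-unique x)))
            (allPairs-map⁺ (AllPairs.map disjoint xs-unique))
    where
    disjoint : ∀ {x x′} → x ≢ x′ → Disjoint (f x) (f x′)
    disjoint {x} x≢x′ (y∈fx , y∈fx′) = x≢x′ (trans (sym (label-f x y∈fx)) (label-f _ y∈fx′))

length-∉ : ∀ {A : Set} {xs : List A} → (∀ {x} → x ∉ xs) → length xs ≡ 0
length-∉ {xs = []}    _   = refl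
length-∉ {xs = _ ∷ _} ∉xs = ⊥-elim (∉xs (here refl))

range : ℕ → ℕ → List ℕ
range a b = applyUpTo (a +_) (suc b ∸ a)

∈-range⁺ : ∀ {a b k} → a ≤ k → k ≤ b → k ∈ range a b
∈-range⁺ {a} {b} {k} a≤k k≤b =
  subst (_∈ range a b) (m+[n∸m]≡n a≤k) (∈-applyUpTo⁺ (a +_) (∸-monoˡ-< (s≤s k≤b) a≤k))

∈-range⁻ : ∀ {a b k} → k ∈ range a b → k ≤ b
∈-range⁻ {a} {b} k∈ with j , j<b+1-a , refl ← ∈-applyUpTo⁻ (a +_) k∈ =
  s≤s⁻¹ (subst (_≤ suc b) (trans (+-comm (suc j) a) (+-suc a j)) (m≤o∸n⇒m+n≤o (suc j) a≤b+1 j<b+1-a))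
  where
  a≤b+1 : a ≤ suc b
  a≤b+1 = <⇒≤ (m∸n≢0⇒n<m (λ b+1-a≡0 → n≮0 (subst (j <_) b+1-a≡0 j<b+1-a)))

range-unique : ∀ a b → Unique (range a b)
range-unique a b = applyUpTo⁺₁ (a +_) (suc b ∸ a) (λ i<j _ a+i≡a+j → <⇒≢ i<j (+-cancelˡ-≡ a _ _ a+i≡a+j))

_≡ᵇ_ : Step → Step → Bool
U ≡ᵇ U = true
D ≡ᵇ D = true
H ≡ᵇ H = true
V ≡ᵇ V = true
_ ≡ᵇ _ = false

count : Step → List Step → ℕ
count s []      = 0
count s (t ∷ p) = if s ≡ᵇ t then suc (count s p) else count s p

hcount≡count-H : ∀ p → hcount p ≡ count H p
hcount≡count-H []      = refl
hcount≡count-H (U ∷ p) = hcount≡count-H p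
hcount≡count-H (D ∷ p) = hcount≡count-H p
hcount≡count-H (H ∷ p) = cong suc (hcount≡count-H p)
hcount≡count-H (V ∷ p) = hcount≡count-H p

xlength≡counts : ∀ p → xlength p ≡ count U p + count D p + count H p
xlength≡counts []      = refl
xlength≡counts (U ∷ p) = cong suc (xlength≡counts p)
xlength≡counts (D ∷ p) = trans (cong suc (xlength≡counts p)) (cong (_+ count H p) (sym (+-suc (count U p) (count D p))))
xlength≡counts (H ∷ p) = trans (cong suc (xlength≡counts p)) (sym (+-suc (count U p + count D p) (count H p)))
xlength≡counts (V ∷ p) = xlength≡counts p

walk-balance : ∀ {h p} → Walk h p → h + count U p ≡ count D p + count V p
walk-balance done = refl
walk-balance {h} {U ∷ p} (up w)   = trans (+-suc h (count U p)) (walk-balance w)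
walk-balance         (down w)     = cong suc (walk-balance w)
walk-balance         (horz w)     = walk-balance w
walk-balance {p = V ∷ p} (vert w) = trans (cong suc (walk-balance w)) (sym (+-suc (count D p) (count V p)))

-- Walks are grouped by their first step; nothing stands for the empty walk.
firstSteps : List (Maybe Step)
firstSteps = nothing ∷ just H ∷ just U ∷ just D ∷ just V ∷ []

mutual
  walks : ℕ → ℕ → ℕ → ℕ → ℕ → List (List Step)
  walks h u d v c = concatMap (λ s → startingWith s h u d v c) firstSteps

  startingWith : Maybe Step → ℕ → ℕ → ℕ → ℕ → ℕ → List (List Step)
  startingWith nothing  zero    zero    zero    zero    zero    = [ [] ]
  startingWith (just H) h       u       d       v       (suc c) = map (H ∷_) (walks h u d v c)
  startingWith (just U) h       (suc u) d       v       c       = map (U ∷_) (walks (suc h) u d v c)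
  startingWith (just D) (suc h) u       (suc d) v       c       = map (D ∷_) (walks h u d v c)
  startingWith (just V) (suc h) u       d       (suc v) c       = map (V ∷_) (walks h u d v c)
  startingWith _        _       _       _       _       _       = []

record WalkWith (h u d v c : ℕ) (p : List Step) : Set where
  constructor walkWith
  field
    walk  : Walk h p
    #U    : count U p ≡ u
    #D    : count D p ≡ d
    #V    : count V p ≡ v
    #H    : count H p ≡ c

∈-walks⁺ : ∀ {h u d v c p} → Any (λ s → p ∈ startingWith s h u d v c) firstSteps → p ∈ walks h u d v c
∈-walks⁺ {h} {u} {d} {v} {c} = ∈-concatMap⁺ (λ s → startingWith s h u d v c)

∈-walks⁻ : ∀ {h u d v c p} → p ∈ walks h u d v c → Any (λ s → p ∈ startingWith s h u d v c) firstSteps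
∈-walks⁻ {h} {u} {d} {v} {c} = ∈-concatMap⁻ (λ s → startingWith s h u d v c)

mutual
  walks-sound : ∀ {h u d v c p} → p ∈ walks h u d v c → WalkWith h u d v c p
  walks-sound p∈ with s , p∈s ← satisfied (∈-walks⁻ p∈) = startingWith-sound s p∈s

  startingWith-sound : ∀ s {h u d v c p} → p ∈ startingWith s h u d v c → WalkWith h u d v c p
  startingWith-sound nothing {zero} {zero} {zero} {zero} {zero} (here refl) = walkWith done refl refl refl refl
  startingWith-sound (just H) {c = suc c} p∈ with q , q∈ , refl ← ∈-map⁻ (H ∷_) p∈
    with walkWith w #U #D #V #H ← walks-sound q∈ = walkWith (horz w) #U #D #V (cong suc #H)
  startingWith-sound (just U) {u = suc u} p∈ with q , q∈ , refl ← ∈-map⁻ (U ∷_) p∈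
    with walkWith w #U #D #V #H ← walks-sound q∈ = walkWith (up w) (cong suc #U) #D #V #H
  startingWith-sound (just D) {suc h} {d = suc d} p∈ with q , q∈ , refl ← ∈-map⁻ (D ∷_) p∈
    with walkWith w #U #D #V #H ← walks-sound q∈ = walkWith (down w) #U (cong suc #D) #V #H
  startingWith-sound (just V) {suc h} {v = suc v} p∈ with q , q∈ , refl ← ∈-map⁻ (V ∷_) p∈
    with walkWith w #U #D #V #H ← walks-sound q∈ = walkWith (vert w) #U #D (cong suc #V) #H

mutual
  walks-complete : ∀ {h p} → Walk h p → p ∈ walks h (count U p) (count D p) (count V p) (count H p)
  walks-complete w = ∈-walks⁺ (startingWith-complete w)

  startingWith-complete : ∀ {h p} → Walk h p →
    Any (λ s → p ∈ startingWith s h (count U p) (count D p) (count V p) (count H p)) firstSteps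
  startingWith-complete done     = here (here refl)
  startingWith-complete (horz w) = there (here (∈-map⁺ (H ∷_) (walks-complete w)))
  startingWith-complete (up w)   = there (there (here (∈-map⁺ (U ∷_) (walks-complete w))))
  startingWith-complete (down w) = there (there (there (here (∈-map⁺ (D ∷_) (walks-complete w)))))
  startingWith-complete (vert w) = there (there (there (there (here (∈-map⁺ (V ∷_) (walks-complete w))))))

∈-walks : ∀ {h u d v c p} → p ∈ walks h u d v c ⇔ WalkWith h u d v c p
∈-walks = mk⇔ walks-sound λ { (walkWith w refl refl refl refl) → walks-complete w }

head-startingWith : ∀ s {h u d v c p} → p ∈ startingWith s h u d v c → head p ≡ s
head-startingWith nothing {zero} {zero} {zero} {zero} {zero} (here refl) = refl
head-startingWith (just H) {c = suc c} p∈ with _ , _ , refl ← ∈-map⁻ (H ∷_) p∈ = refl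
head-startingWith (just U) {u = suc u} p∈ with _ , _ , refl ← ∈-map⁻ (U ∷_) p∈ = refl
head-startingWith (just D) {suc h} {d = suc d} p∈ with _ , _ , refl ← ∈-map⁻ (D ∷_) p∈ = refl
head-startingWith (just V) {suc h} {v = suc v} p∈ with _ , _ , refl ← ∈-map⁻ (V ∷_) p∈ = refl

firstSteps-unique : Unique firstSteps
firstSteps-unique =
  ((λ ()) ∷ (λ ()) ∷ (λ ()) ∷ (λ ()) ∷ []) ∷ ((λ ()) ∷ (λ ()) ∷ (λ ()) ∷ []) ∷
  ((λ ()) ∷ (λ ()) ∷ []) ∷ ((λ ()) ∷ []) ∷ [] ∷ []

mutual
  walks-unique : ∀ h u d v c → Unique (walks h u d v c)
  walks-unique h u d v c =
    concatMap-unique (λ s → startingWith s h u d v c) head (λ s → head-startingWith s)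
      (λ s → startingWith-unique s h u d v c) firstSteps-unique

  startingWith-unique : ∀ s h u d v c → Unique (startingWith s h u d v c)
  startingWith-unique nothing  zero    zero    zero    zero    zero    = [] ∷ []
  startingWith-unique nothing  zero    zero    zero    zero    (suc c) = []
  startingWith-unique nothing  zero    zero    zero    (suc v) c       = []
  startingWith-unique nothing  zero    zero    (suc d) v       c       = []
  startingWith-unique nothing  zero    (suc u) d       v       c       = []
  startingWith-unique nothing  (suc h) u       d       v       c       = []
  startingWith-unique (just H) h       u       d       v       zero    = []
  startingWith-unique (just H) h       u       d       v       (suc c) = map⁺ ∷-injectiveʳ (walks-unique h u d v c)
  startingWith-unique (just U) h       zero    d       v       c       = []
  startingWith-unique (just U) h       (suc u) d       v       c       = map⁺ ∷-injectiveʳ (walks-unique (suc h) u d v c)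
  startingWith-unique (just D) zero    u       d       v       c       = []
  startingWith-unique (just D) (suc h) u       zero    v       c       = []
  startingWith-unique (just D) (suc h) u       (suc d) v       c       = map⁺ ∷-injectiveʳ (walks-unique h u d v c)
  startingWith-unique (just V) zero    u       d       v       c       = []
  startingWith-unique (just V) (suc h) u       d       zero    c       = []
  startingWith-unique (just V) (suc h) u       d       (suc v) c       = map⁺ ∷-injectiveʳ (walks-unique h u d v c)

moves : ℕ → ℕ → ℕ → ℕ → ℕ → ℕ
moves h u d v c = length (startingWith (just U) h u d v c)
                + (length (startingWith (just D) h u d v c) + length (startingWith (just V) h u d v c))

length-walks : ∀ h u d v c → length (walks h u d v c) ≡
  length (startingWith nothing h u d v c) + (length (startingWith (just H) h u d v c) + moves h u d v c)
length-walks h u d v c = trans (length-concatMap (λ s → startingWith s h u d v c) firstSteps)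
  (drop-zero (length (startingWith nothing h u d v c)) (length (startingWith (just H) h u d v c))
    (length (startingWith (just U) h u d v c)) (length (startingWith (just D) h u d v c))
    (length (startingWith (just V) h u d v c)))
  where
  drop-zero : ∀ a b x y z → a + (b + (x + (y + (z + 0)))) ≡ a + (b + (x + (y + z)))
  drop-zero = solve-∀

length-startingWith-nothing : ∀ h u d v c {p} → u + d + v ≡ suc p → length (startingWith nothing h u d v c) ≡ 0
length-startingWith-nothing (suc h) u       d       v       c _  = refl
length-startingWith-nothing zero    (suc u) d       v       c _  = refl
length-startingWith-nothing zero    zero    (suc d) v       c _  = refl
length-startingWith-nothing zero    zero    zero    (suc v) c _  = refl
length-startingWith-nothing zero    zero    zero    zero    c ()

length-walks-horizontal : ∀ h c → length (walks h 0 0 0 (suc c)) ≡ length (walks h 0 0 0 c)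
length-walks-horizontal zero    c = trans (length-walks 0 0 0 0 (suc c)) (trans (+-identityʳ _) (length-map (H ∷_) (walks 0 0 0 0 c)))
length-walks-horizontal (suc h) c = trans (length-walks (suc h) 0 0 0 (suc c)) (trans (+-identityʳ _) (length-map (H ∷_) (walks (suc h) 0 0 0 c)))

length-prefix-shuffle : ∀ s (ws : ℕ → List (List Step)) {q p c} → q ≡ p →
  length (ws c) ≡ shuffles q c * length (ws 0) →
  length (map (s ∷_) (ws c)) ≡ shuffles p c * length (map (s ∷_) (ws 0))
length-prefix-shuffle s ws {q} {c = c} refl eq =
  trans (length-map (s ∷_) (ws c)) (trans eq (cong (shuffles q c *_) (sym (length-map (s ∷_) (ws 0)))))

mutual
  length-walks-shuffle : ∀ h u d v c → length (walks h u d v c) ≡ shuffles (u + d + v) c * length (walks h u d v 0)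
  length-walks-shuffle h zero    zero    zero    zero    = sym (+-identityʳ _)
  length-walks-shuffle h zero    zero    zero    (suc c) = trans (length-walks-horizontal h c) (length-walks-shuffle h 0 0 0 c)
  length-walks-shuffle h (suc u) d       v       c       = length-walks-shuffle-suc h (suc u) d v c refl
  length-walks-shuffle h zero    (suc d) v       c       = length-walks-shuffle-suc h zero (suc d) v c refl
  length-walks-shuffle h zero    zero    (suc v) c       = length-walks-shuffle-suc h zero zero (suc v) c refl

  length-walks-shuffle-suc : ∀ h u d v c {p} → u + d + v ≡ suc p →
    length (walks h u d v c) ≡ shuffles (suc p) c * length (walks h u d v 0)
  length-walks-shuffle-suc h u d v c {p} e = begin
    length (walks h u d v c)
      ≡⟨ length-walks h u d v c ⟩
    length (startingWith nothing h u d v c) + (length (startingWith (just H) h u d v c) + moves h u d v c)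
      ≡⟨ cong (λ x → x + (length (startingWith (just H) h u d v c) + moves h u d v c)) (length-startingWith-nothing h u d v c e) ⟩
    length (startingWith (just H) h u d v c) + moves h u d v c
      ≡⟨ cong (length (startingWith (just H) h u d v c) +_) (moves-shuffle h u d v c e) ⟩
    length (startingWith (just H) h u d v c) + shuffles p c * moves h u d v 0
      ≡⟨ horizontal c ⟩
    shuffles (suc p) c * moves h u d v 0
      ≡⟨ cong (shuffles (suc p) c *_) walks₀≡moves₀ ⟨
    shuffles (suc p) c * length (walks h u d v 0) ∎
    where
    walks₀≡moves₀ : length (walks h u d v 0) ≡ moves h u d v 0
    walks₀≡moves₀ = trans (length-walks h u d v 0) (cong (_+ moves h u d v 0) (length-startingWith-nothing h u d v 0 e))
    horizontal : ∀ c → length (startingWith (just H) h u d v c) + shuffles p c * moves h u d v 0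
                     ≡ shuffles (suc p) c * moves h u d v 0
    horizontal zero    = cong (_* moves h u d v 0) (shuffles-zeroʳ p)
    horizontal (suc c) = begin
      length (map (H ∷_) (walks h u d v c)) + shuffles p (suc c) * moves h u d v 0
        ≡⟨ cong (_+ shuffles p (suc c) * moves h u d v 0) (length-map (H ∷_) (walks h u d v c)) ⟩
      length (walks h u d v c) + shuffles p (suc c) * moves h u d v 0
        ≡⟨ cong (_+ shuffles p (suc c) * moves h u d v 0)
                (trans (length-walks-shuffle-suc h u d v c e) (cong (shuffles (suc p) c *_) walks₀≡moves₀)) ⟩
      shuffles (suc p) c * moves h u d v 0 + shuffles p (suc c) * moves h u d v 0
        ≡⟨ +-comm (shuffles (suc p) c * moves h u d v 0) _ ⟩
      shuffles p (suc c) * moves h u d v 0 + shuffles (suc p) c * moves h u d v 0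
        ≡⟨ *-distribʳ-+ (moves h u d v 0) (shuffles p (suc c)) (shuffles (suc p) c) ⟨
      shuffles (suc p) (suc c) * moves h u d v 0 ∎

  moves-shuffle : ∀ h u d v c {p} → u + d + v ≡ suc p → moves h u d v c ≡ shuffles p c * moves h u d v 0
  moves-shuffle h u d v c {p} e = begin
    length (startingWith (just U) h u d v c) + (length (startingWith (just D) h u d v c) + length (startingWith (just V) h u d v c))
      ≡⟨ cong₂ _+_ (length-move-shuffle U (λ ()) h u d v c e)
                   (cong₂ _+_ (length-move-shuffle D (λ ()) h u d v c e) (length-move-shuffle V (λ ()) h u d v c e)) ⟩
    shuffles p c * U₀ + (shuffles p c * D₀ + shuffles p c * V₀)
      ≡⟨ cong (shuffles p c * U₀ +_) (*-distribˡ-+ (shuffles p c) D₀ V₀) ⟨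
    shuffles p c * U₀ + shuffles p c * (D₀ + V₀)
      ≡⟨ *-distribˡ-+ (shuffles p c) U₀ (D₀ + V₀) ⟨
    shuffles p c * (U₀ + (D₀ + V₀)) ∎
    where
    U₀ = length (startingWith (just U) h u d v 0)
    D₀ = length (startingWith (just D) h u d v 0)
    V₀ = length (startingWith (just V) h u d v 0)

  length-move-shuffle : ∀ s → s ≢ H → ∀ h u d v c {p} → u + d + v ≡ suc p →
    length (startingWith (just s) h u d v c) ≡ shuffles p c * length (startingWith (just s) h u d v 0)
  length-move-shuffle U _ h       zero    d       v       c {p} e = sym (*-zeroʳ (shuffles p c))
  length-move-shuffle U _ h       (suc u) d       v       c e =
    length-prefix-shuffle U (walks (suc h) u d v) (suc-injective e) (length-walks-shuffle (suc h) u d v c)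
  length-move-shuffle D _ zero    u       d       v       c {p} e = sym (*-zeroʳ (shuffles p c))
  length-move-shuffle D _ (suc h) u       zero    v       c {p} e = sym (*-zeroʳ (shuffles p c))
  length-move-shuffle D _ (suc h) u       (suc d) v       c e =
    length-prefix-shuffle D (walks h u d v) (suc-injective (trans (cong (_+ v) (sym (+-suc u d))) e)) (length-walks-shuffle h u d v c)
  length-move-shuffle V _ zero    u       d       v       c {p} e = sym (*-zeroʳ (shuffles p c))
  length-move-shuffle V _ (suc h) u       d       zero    c {p} e = sym (*-zeroʳ (shuffles p c))
  length-move-shuffle V _ (suc h) u       d       (suc v) c e =
    length-prefix-shuffle V (walks h u d v) (suc-injective (trans (sym (+-suc (u + d) v)) e)) (length-walks-shuffle h u d v c)
  length-move-shuffle H H≢H _ _ _ _ _ _ = ⊥-elim (H≢H refl)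

mutual
  length-walks-without-H : ∀ h u d v → h + u ≡ d + v → length (walks h u d v 0) ≡ shuffles d v * ballot h u
  length-walks-without-H zero    zero    zero    zero    _  = refl
  length-walks-without-H zero    zero    zero    (suc v) ()
  length-walks-without-H zero    zero    (suc d) v       ()
  length-walks-without-H zero    (suc u) d       v       e  = begin
    length (walks 0 (suc u) d v 0)             ≡⟨ length-walks 0 (suc u) d v 0 ⟩
    length (map (U ∷_) (walks 1 u d v 0)) + 0  ≡⟨ +-identityʳ _ ⟩
    length (map (U ∷_) (walks 1 u d v 0))      ≡⟨ length-map (U ∷_) (walks 1 u d v 0) ⟩
    length (walks 1 u d v 0)                   ≡⟨ length-walks-without-H 1 u d v e ⟩
    shuffles d v * ballot 1 u ∎
  length-walks-without-H (suc h) u       d       v       e  = trans (length-walks (suc h) u d v 0) (moves-without-H h u d v e)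

  moves-without-H : ∀ h u d v → suc h + u ≡ d + v → moves (suc h) u d v 0 ≡ shuffles d v * ballot (suc h) u
  moves-without-H h zero    d v e = falls-without-H h 0 d v e
  moves-without-H h (suc u) d v e = begin
    length (map (U ∷_) (walks (suc (suc h)) u d v 0)) + falls
      ≡⟨ cong₂ _+_ (trans (length-map (U ∷_) (walks (suc (suc h)) u d v 0)) (length-walks-without-H (suc (suc h)) u d v e′))
                   (falls-without-H h (suc u) d v e) ⟩
    shuffles d v * ballot (suc (suc h)) u + shuffles d v * ballot h (suc u)
      ≡⟨ +-comm (shuffles d v * ballot (suc (suc h)) u) _ ⟩
    shuffles d v * ballot h (suc u) + shuffles d v * ballot (suc (suc h)) u
      ≡⟨ *-distribˡ-+ (shuffles d v) (ballot h (suc u)) (ballot (suc (suc h)) u) ⟨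
    shuffles d v * ballot (suc h) (suc u) ∎
    where
    falls = length (startingWith (just D) (suc h) (suc u) d v 0) + length (startingWith (just V) (suc h) (suc u) d v 0)
    e′ : suc (suc h) + u ≡ d + v
    e′ = trans (cong suc (sym (+-suc h u))) e

  falls-without-H : ∀ h u d v → suc h + u ≡ d + v →
    length (startingWith (just D) (suc h) u d v 0) + length (startingWith (just V) (suc h) u d v 0) ≡ shuffles d v * ballot h u
  falls-without-H h u zero    zero    ()
  falls-without-H h u zero    (suc v) e = trans (length-map (V ∷_) (walks h u 0 v 0)) (length-walks-without-H h u 0 v (suc-injective e))
  falls-without-H h u (suc d) zero    e = begin
    length (map (D ∷_) (walks h u d 0 0)) + 0 ≡⟨ +-identityʳ _ ⟩
    length (map (D ∷_) (walks h u d 0 0))     ≡⟨ length-map (D ∷_) (walks h u d 0 0) ⟩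
    length (walks h u d 0 0)                  ≡⟨ length-walks-without-H h u d 0 (suc-injective e) ⟩
    shuffles d 0 * ballot h u                 ≡⟨ cong (_* ballot h u) (shuffles-zeroʳ d) ⟩
    1 * ballot h u ∎
  falls-without-H h u (suc d) (suc v) e = begin
    length (map (D ∷_) (walks h u d (suc v) 0)) + length (map (V ∷_) (walks h u (suc d) v 0))
      ≡⟨ cong₂ _+_ (length-map (D ∷_) (walks h u d (suc v) 0)) (length-map (V ∷_) (walks h u (suc d) v 0)) ⟩
    length (walks h u d (suc v) 0) + length (walks h u (suc d) v 0)
      ≡⟨ cong₂ _+_ (length-walks-without-H h u d (suc v) (suc-injective e))
                   (length-walks-without-H h u (suc d) v (trans (suc-injective e) (+-suc d v))) ⟩
    shuffles d (suc v) * ballot h u + shuffles (suc d) v * ballot h u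
      ≡⟨ *-distribʳ-+ (ballot h u) (shuffles d (suc v)) (shuffles (suc d) v) ⟨
    shuffles (suc d) (suc v) * ballot h u ∎

-- A G-Motzkin path with k up and d down steps has k ∸ d vertical steps (none exist if d > k).
gMotzkinWith : ℕ → ℕ → ℕ → List (List Step)
gMotzkinWith k d i = walks 0 k d (k ∸ d) i

gMotzkinWith-sound : ∀ k d i {p} → p ∈ gMotzkinWith k d i → WalkWith 0 k d (k ∸ d) i p
gMotzkinWith-sound k d i = walks-sound

length-gMotzkinWith : ∀ k d i → length (gMotzkinWith k d i) ≡ ((2 * k + i) C (2 * k)) * ((k C d) * catalan k)
length-gMotzkinWith k d i with d ≤? k
... | yes d≤k = begin
  length (walks 0 k d (k ∸ d) i)
    ≡⟨ length-walks-shuffle 0 k d (k ∸ d) i ⟩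
  shuffles (k + d + (k ∸ d)) i * length (walks 0 k d (k ∸ d) 0)
    ≡⟨ cong₂ (λ x y → shuffles x i * y) k+d+[k∸d]≡2k (length-walks-without-H 0 k d (k ∸ d) (sym d+[k∸d]≡k)) ⟩
  shuffles (2 * k) i * (shuffles d (k ∸ d) * ballot 0 k)
    ≡⟨ cong₂ (λ x y → x * (y * ballot 0 k)) (shuffles≡C (2 * k) i) (trans (shuffles≡C d (k ∸ d)) (cong (_C d) d+[k∸d]≡k)) ⟩
  ((2 * k + i) C (2 * k)) * ((k C d) * ballot 0 k)
    ≡⟨ cong (λ x → ((2 * k + i) C (2 * k)) * ((k C d) * x)) (ballot-zero≡catalan k) ⟩
  ((2 * k + i) C (2 * k)) * ((k C d) * catalan k) ∎
  where
  d+[k∸d]≡k : d + (k ∸ d) ≡ k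
  d+[k∸d]≡k = m+[n∸m]≡n d≤k
  k+d+[k∸d]≡2k : k + d + (k ∸ d) ≡ 2 * k
  k+d+[k∸d]≡2k = trans (+-assoc k d (k ∸ d)) (cong (k +_) (trans d+[k∸d]≡k (sym (+-identityʳ k))))
... | no d≰k = begin
  length (gMotzkinWith k d i)                       ≡⟨ length-∉ unbalanced ⟩
  0                                                 ≡⟨ *-zeroʳ ((2 * k + i) C (2 * k)) ⟨
  ((2 * k + i) C (2 * k)) * 0
    ≡⟨ cong (λ x → ((2 * k + i) C (2 * k)) * (x * catalan k)) (k>n⇒nCk≡0 (≰⇒> d≰k)) ⟨
  ((2 * k + i) C (2 * k)) * ((k C d) * catalan k) ∎
  where
  unbalanced : ∀ {p} → p ∉ gMotzkinWith k d i
  unbalanced {p} p∈ with walkWith w #U #D _ _ ← gMotzkinWith-sound k d i p∈ =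
    d≰k (subst₂ _≤_ #D #U (subst (count D p ≤_) (sym (walk-balance w)) (m≤m+n (count D p) (count V p))))

gMotzkinPaths : ℕ → ℕ → List (List Step)
gMotzkinPaths n i = concatMap (λ k → gMotzkinWith k (n ∸ i ∸ k) i) (range ((n ∸ i) / 2) (n ∸ i))

length-gMotzkinPaths : ∀ n i → length (gMotzkinPaths n i) ≡ Hformula n i
length-gMotzkinPaths n i =
  trans (length-concatMap (λ k → gMotzkinWith k (n ∸ i ∸ k) i) (range ((n ∸ i) / 2) (n ∸ i)))
        (cong sum (map-cong (λ k → length-gMotzkinWith k (n ∸ i ∸ k) i) (range ((n ∸ i) / 2) (n ∸ i))))

gMotzkinPaths-unique : ∀ n i → Unique (gMotzkinPaths n i)
gMotzkinPaths-unique n i =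
  concatMap-unique (λ k → gMotzkinWith k (n ∸ i ∸ k) i) (count U)
    (λ k p∈ → WalkWith.#U (gMotzkinWith-sound k (n ∸ i ∸ k) i p∈))
    (λ k → walks-unique 0 k (n ∸ i ∸ k) (k ∸ (n ∸ i ∸ k)) i) (range-unique ((n ∸ i) / 2) (n ∸ i))

gMotzkinPaths-sound : ∀ {n i p} → i ≤ n → p ∈ gMotzkinPaths n i → GMotzkin n i p
gMotzkinPaths-sound {n} {i} {p} i≤n p∈
  with k , k∈range , p∈k ← find (∈-concatMap⁻ (λ k → gMotzkinWith k (n ∸ i ∸ k) i) {xs = range ((n ∸ i) / 2) (n ∸ i)} p∈)
  with walkWith w #U #D _ #H ← gMotzkinWith-sound k (n ∸ i ∸ k) i p∈k = gm w (begin
    xlength p                          ≡⟨ xlength≡counts p ⟩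
    count U p + count D p + count H p  ≡⟨ cong₂ (λ x y → x + y + count H p) #U #D ⟩
    k + (n ∸ i ∸ k) + count H p        ≡⟨ cong₂ _+_ (m+[n∸m]≡n (∈-range⁻ k∈range)) #H ⟩
    n ∸ i + i                          ≡⟨ m∸n+n≡m i≤n ⟩
    n ∎) (trans (hcount≡count-H p) #H)

gMotzkinPaths-complete : ∀ {n i p} → GMotzkin n i p → p ∈ gMotzkinPaths n i
gMotzkinPaths-complete {n} {i} {p} (gm w len hs) =
  ∈-concatMap⁺ (λ k → gMotzkinWith k (n ∸ i ∸ k) i) (lose (∈-range⁺ half≤k k≤m) p∈block)
  where
  k = count U p
  d = count D p
  k≡d+v : k ≡ d + count V p
  k≡d+v = walk-balance w
  k+d≡m : k + d ≡ n ∸ i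
  k+d≡m = begin
    k + d                      ≡⟨ m+n∸n≡m (k + d) i ⟨
    k + d + i ∸ i              ≡⟨ cong (λ x → k + d + x ∸ i) (trans (sym hs) (hcount≡count-H p)) ⟩
    k + d + count H p ∸ i      ≡⟨ cong (_∸ i) (trans (sym (xlength≡counts p)) len) ⟩
    n ∸ i ∎
  d≡m∸k : d ≡ n ∸ i ∸ k
  d≡m∸k = trans (sym (m+n∸m≡n k d)) (cong (_∸ k) k+d≡m)
  p∈block : p ∈ gMotzkinWith k (n ∸ i ∸ k) i
  p∈block = Equivalence.from ∈-walks (walkWith w refl d≡m∸k
    (trans (sym (m+n∸m≡n d (count V p))) (cong₂ _∸_ (sym k≡d+v) d≡m∸k))
    (trans (sym (hcount≡count-H p)) hs))
  k≤m : k ≤ n ∸ i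
  k≤m = subst (k ≤_) k+d≡m (m≤m+n k d)
  half≤k : (n ∸ i) / 2 ≤ k
  half≤k = ≤-trans (/-monoˡ-≤ 2 m≤k*2) (≤-reflexive (m*n/n≡m k 2))
    where
    m≤k*2 : n ∸ i ≤ k * 2
    m≤k*2 = subst₂ _≤_ k+d≡m (trans (cong (k +_) (sym (+-identityʳ k))) (*-comm 2 k))
              (+-monoʳ-≤ k (subst (d ≤_) (sym k≡d+v) (m≤m+n d (count V p))))

theorem2p4 : (n i : ℕ) → i ≤ n →
    Σ (List (List Step)) (λ L →
      Unique L × ((p : List Step) → (p ∈ L) ⇔ GMotzkin n i p) × (length L ≡ Hformula n i))
theorem2p4 n i i≤n =
  gMotzkinPaths n i ,
  gMotzkinPaths-unique n i ,
  (λ p → mk⇔ (gMotzkinPaths-sound i≤n) gMotzkinPaths-complete) ,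
  length-gMotzkinPaths n i
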